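{- Let $\kappa$ be the graph obtained from $K_{2,3}$ by subdividing one edge once (equivalently, the theta graph consisting of three internally disjoint paths of lengths $2,2,3$ between two distinct vertices). Then $\kappa$ is not $i$-graph realizable; that is, there is no graph $G$ with $\mathcal{I}(G)\cong\kappa$.
   Context: All graphs are finite and simple. For a graph $G$, $i(G)$ denotes the minimum cardinality of an independent dominating set of $G$; an independent dominating set of cardinality $i(G)$ is an $i$-set of $G$. The $i$-graph $\mathcal{I}(G)$ of $G$ is the graph whose vertices are the $i$-sets of $G$, where two $i$-sets $S$ and $S'$ are adjacent if and only if there is an edge $xy\in E(G)$ with $S'=(S-\{x\})\cup\{y\}$. A graph $H$ is $i$-graph realizable if there exists a graph $G$ with $\mathcal{I}(G)\cong H$. -}

module Defs where

open import Data.Nat using (ℕ; _≤_)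
open import Data.Bool using (Bool; true; false)
open import Data.Fin using (Fin; zero; suc)
open import Data.Fin.Subset using (Subset; _∈_; _∉_; _-_; _∪_; ⁅_⁆; ∣_∣)
open import Data.Product using (Σ; ∃; ∃-syntax; _×_; _,_)
open import Data.Sum using (_⊎_)
open import Relation.Binary.PropositionalEquality using (_≡_; _≢_)

record Graph : Set where
  field
    n      : ℕ
    adj    : Fin n → Fin n → Bool
    sym    : ∀ x y → adj x y ≡ adj y x
    irrefl : ∀ x → adj x x ≡ false

open Graph public

module _ (G : Graph) where

  Independent : Subset (n G) → Set
  Independent S = ∀ x y → x ∈ S → y ∈ S → adj G x y ≡ false

  Dominating : Subset (n G) → Set
  Dominating S = ∀ v → v ∈ S ⊎ (∃[ u ] (u ∈ S × adj G u v ≡ true))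

  IndependentDominating : Subset (n G) → Set
  IndependentDominating S = Independent S × Dominating S

  IsISet : Subset (n G) → Set
  IsISet S = IndependentDominating S ×
             (∀ T → IndependentDominating T → ∣ S ∣ ≤ ∣ T ∣)

  -- adjacency in the i-graph: S' = (S - {x}) ∪ {y} for an edge xy of G
  -- (with x ∈ S and y ∉ S, i.e. a genuine token move, S ≠ S')
  ISetAdj : Subset (n G) → Subset (n G) → Set
  ISetAdj S S' = ∃[ x ] ∃[ y ]
    (adj G x y ≡ true × x ∈ S × y ∉ S × S' ≡ (S - x) ∪ ⁅ y ⁆)

-- The graph κ: K_{2,3} with one edge subdivided once.
-- Vertices 0,1 are the two branch vertices; the three internally disjoint
-- 0–1 paths are 0-2-1, 0-3-1 and 0-4-5-1 (lengths 2, 2, 3).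
κ-edge : Fin 6 → Fin 6 → Bool
κ-edge zero (suc (suc zero)) = true
κ-edge (suc (suc zero)) (suc zero) = true
κ-edge zero (suc (suc (suc zero))) = true
κ-edge (suc (suc (suc zero))) (suc zero) = true
κ-edge zero (suc (suc (suc (suc zero)))) = true
κ-edge (suc (suc (suc (suc zero)))) (suc (suc (suc (suc (suc zero))))) = true
κ-edge (suc (suc (suc (suc (suc zero))))) (suc zero) = true
κ-edge _ _ = false

κ-adj : Fin 6 → Fin 6 → Bool
κ-adj x y with κ-edge x y
... | true  = true
... | false = κ-edge y x

-- f : Fin 6 → Subset (n G) is an isomorphism from κ onto the i-graph of G
-- (whose vertices are the i-sets, identified by their underlying sets):
-- each f k is an i-set, f is injective, every i-set is some f k, and
-- κ-adjacency corresponds exactly to i-graph adjacency.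
IsIsoFromκ : (G : Graph) → (Fin 6 → Subset (n G)) → Set
IsIsoFromκ G f =
  (∀ k → IsISet G (f k)) ×
  (∀ k l → f k ≡ f l → k ≡ l) ×
  (∀ S → IsISet G S → ∃[ k ] (f k ≡ S)) ×
  (∀ k l → (κ-adj k l ≡ true → ISetAdj G (f k) (f l)) ×
           (ISetAdj G (f k) (f l) → κ-adj k l ≡ true))

IGraphIsoκ : Graph → Set
IGraphIsoκ G = ∃[ f ] IsIsoFromκ G f

{-# OPTIONS --safe #-}
-- Two swaps out of one i-set that remove the same vertex, or add the same vertex, end in
-- adjacent or equal i-sets, and an i-set two swaps away from A gains only the two vertices
-- added on the way. Write A, …, F for the i-sets at the vertices a, …, f of κ. The swaps
-- A → C and A → D remove distinct vertices x₁, x₃ and add distinct neighbours y₁, y₃ of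
-- them; then B \ A = {y₁, y₃}, and the swaps B → C and B → D remove y₃ and y₁. Hence A → E
-- removes neither x₁ nor x₃ and B → F removes neither y₁ nor y₃, so the single swap E → F
-- would have to add both y₁ and y₃, each adjacent to a vertex of the independent set E.
module Submission where

open import Data.Bool using (true; false)
open import Data.Empty using (⊥-elim)
open import Data.Fin using (Fin; zero; suc; _≟_)
open import Data.Fin.Subset using (Subset; _∈_; _∉_; _─_; _-_; _∪_; ⁅_⁆; inside; outside)
open import Data.Fin.Subset.Properties
  using (x∈⁅x⁆; x∈⁅y⁆⇒x≡y; x∉⁅y⁆⇒x≢y; x∈p∪q⁻; x∈p∪q⁺; x∈p∧x≢y⇒x∈p-y; p─q⊆p; ⊆-antisym)
open import Data.Nat using (ℕ)
open import Data.Product using (Σ; proj₁; proj₂; _,_; _×_; ∃-syntax)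
open import Data.Sum using (_⊎_; inj₁; inj₂; [_,_]; fromInj₂)
open import Data.Vec.Base using (_∷_; here; there)
open import Function using (_∘_)
open import Relation.Nullary using (¬_; yes; no; contradiction)
open import Relation.Binary.PropositionalEquality
  using (_≡_; _≢_; refl; sym; trans; cong; subst; module ≡-Reasoning)

open import Defs hiding (sym)

private
  variable
    m : ℕ

x∈p─q⇒x∉q : ∀ {x : Fin m} {p q : Subset m} → x ∈ p ─ q → x ∉ q
x∈p─q⇒x∉q {p = _ ∷ _} {outside ∷ _} here      ()
x∈p─q⇒x∉q {p = _ ∷ _} {inside  ∷ _} ()        here
x∈p─q⇒x∉q {p = _ ∷ _} {_       ∷ _} (there h) (there k) = x∈p─q⇒x∉q h k

infixl 5 _[_↦_]

_[_↦_] : Subset m → Fin m → Fin m → Subset m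
S [ x ↦ y ] = (S - x) ∪ ⁅ y ⁆

module _ {S : Subset m} {x y : Fin m} where

  ∈-↦-added : y ∈ S [ x ↦ y ]
  ∈-↦-added = x∈p∪q⁺ (inj₂ (x∈⁅x⁆ y))

  ∈-↦-kept : ∀ {z} → z ∈ S → z ≢ x → z ∈ S [ x ↦ y ]
  ∈-↦-kept z∈S z≢x = x∈p∪q⁺ (inj₁ (x∈p∧x≢y⇒x∈p-y z∈S z≢x))

  ∈-↦⁻ : ∀ {z} → z ∈ S [ x ↦ y ] → z ≡ y ⊎ (z ∈ S × z ≢ x)
  ∈-↦⁻ z∈ with x∈p∪q⁻ (S - x) ⁅ y ⁆ z∈
  ... | inj₁ z∈S-x = inj₂ (p─q⊆p S ⁅ x ⁆ z∈S-x , x∉⁅y⁆⇒x≢y (x∈p─q⇒x∉q z∈S-x))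
  ... | inj₂ z∈⁅y⁆ = inj₁ (x∈⁅y⁆⇒x≡y y z∈⁅y⁆)

↦-self : ∀ {S : Subset m} {x} → x ∈ S → S [ x ↦ x ] ≡ S
↦-self {S = S} {x} x∈S = ⊆-antisym ⊆S S⊆
  where
  ⊆S : ∀ {z} → z ∈ S [ x ↦ x ] → z ∈ S
  ⊆S z∈ with ∈-↦⁻ z∈
  ... | inj₁ refl       = x∈S
  ... | inj₂ (z∈S , _) = z∈S

  S⊆ : ∀ {z} → z ∈ S → z ∈ S [ x ↦ x ]
  S⊆ {z} z∈S with z ≟ x
  ... | yes refl = ∈-↦-added
  ... | no z≢x   = ∈-↦-kept z∈S z≢x

↦-∘ : ∀ {S : Subset m} {x y z} → y ∉ S → S [ x ↦ y ] [ y ↦ z ] ≡ S [ x ↦ z ]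
↦-∘ {S = S} {x} {y} {z} y∉S = ⊆-antisym ⊆↦ ↦⊆
  where
  ⊆↦ : ∀ {w} → w ∈ S [ x ↦ y ] [ y ↦ z ] → w ∈ S [ x ↦ z ]
  ⊆↦ w∈ with ∈-↦⁻ w∈
  ... | inj₁ refl = ∈-↦-added
  ... | inj₂ (w∈S[x↦y] , w≢y) with ∈-↦⁻ w∈S[x↦y]
  ...   | inj₁ w≡y           = contradiction w≡y w≢y
  ...   | inj₂ (w∈S , w≢x) = ∈-↦-kept w∈S w≢x

  ↦⊆ : ∀ {w} → w ∈ S [ x ↦ z ] → w ∈ S [ x ↦ y ] [ y ↦ z ]
  ↦⊆ w∈ with ∈-↦⁻ w∈
  ... | inj₁ refl           = ∈-↦-added
  ... | inj₂ (w∈S , w≢x) = ∈-↦-kept (∈-↦-kept w∈S w≢x) λ { refl → y∉S w∈S }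

module _ (G : Graph) where

  private
    V = Fin (n G)
    Sub = Subset (n G)
    variable
      A B C D S T : Sub
      u v x y z x′ y′ : V

  record Swap (S T : Sub) (x y : V) : Set where
    field
      edge : adj G x y ≡ true
      x∈S  : x ∈ S
      y∉S  : y ∉ S
      T≡   : T ≡ S [ x ↦ y ]

    y∈T : y ∈ T
    y∈T = subst (y ∈_) (sym T≡) ∈-↦-added

    ∈T⁻ : z ∈ T → z ≡ y ⊎ (z ∈ S × z ≢ x)
    ∈T⁻ {z} z∈T = ∈-↦⁻ (subst (z ∈_) T≡ z∈T)

    ∈S⇒∈T : z ∈ S → z ≢ x → z ∈ T
    ∈S⇒∈T {z} z∈S z≢x = subst (z ∈_) (sym T≡) (∈-↦-kept z∈S z≢x)

    x∉T : x ∉ T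
    x∉T x∈T with ∈T⁻ x∈T
    ... | inj₁ refl       = y∉S x∈S
    ... | inj₂ (_ , x≢x) = x≢x refl

  open Swap

  Adjacent : Sub → Sub → Set
  Adjacent S T = ∃[ x ] ∃[ y ] Swap S T x y

  ISetAdj⇒Adjacent : ISetAdj G S T → Adjacent S T
  ISetAdj⇒Adjacent (x , y , e , x∈S , y∉S , T≡) = x , y , record
    { edge = e ; x∈S = x∈S ; y∉S = y∉S ; T≡ = T≡ }

  Adjacent⇒ISetAdj : Adjacent S T → ISetAdj G S T
  Adjacent⇒ISetAdj (x , y , s) = x , y , edge s , x∈S s , y∉S s , T≡ s

  independent⇒¬adj : Independent G S → x ∈ S → y ∈ S → ¬ (adj G x y ≡ true)
  independent⇒¬adj ind x∈S y∈S e with trans (sym e) (ind _ _ x∈S y∈S)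
  ... | ()

  -- y is dominated by some vertex of S, and any dominator other than x would lie in T with y.
  removed-adj-added : Dominating G S → Independent G T → y ∈ T → y ∉ S →
                      (∀ {u} → u ∈ S → u ≢ x → u ∈ T) → adj G x y ≡ true
  removed-adj-added {x = x} dom ind y∈T y∉S S⊆T with dom _
  ... | inj₁ y∈S = contradiction y∈S y∉S
  ... | inj₂ (u , u∈S , u~y) with u ≟ x
  ...   | yes refl = u~y
  ...   | no u≢x   = contradiction u~y (independent⇒¬adj ind (S⊆T u∈S u≢x) y∈T)

  exchange⇒Swap : T ≡ S [ x ↦ y ] → Dominating G S → Independent G T →
                  x ∈ S → y ∉ S → Swap S T x y
  exchange⇒Swap refl dom ind x∈S y∉S = record
    { edge = removed-adj-added dom ind ∈-↦-added y∉S ∈-↦-kept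
    ; x∈S  = x∈S
    ; y∉S  = y∉S
    ; T≡   = refl
    }

  swap-then-move-added : Swap A C x y → Swap C B y z → B ≡ A [ x ↦ z ]
  swap-then-move-added {A = A} {C = C} {x = x} {y = y} {B = B} {z = z} s t = begin
    B                     ≡⟨ T≡ t ⟩
    C [ y ↦ z ]           ≡⟨ cong (_[ y ↦ z ]) (T≡ s) ⟩
    A [ x ↦ y ] [ y ↦ z ] ≡⟨ ↦-∘ (y∉S s) ⟩
    A [ x ↦ z ]           ∎
    where open ≡-Reasoning

  backtrack : Dominating G A → Independent G B → Swap A C x y → Swap C B y z →
              A ≡ B ⊎ Adjacent A B
  backtrack {A = A} {x = x} {z = z} dom ind s t with z ≟ x
  ... | yes refl = inj₁ (sym (trans (swap-then-move-added s t) (↦-self (x∈S s))))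
  ... | no z≢x   = inj₂ (x , z , exchange⇒Swap (swap-then-move-added s t) dom ind (x∈S s) z∉A)
    where
    z∉A : z ∉ A
    z∉A z∈A = y∉S t (∈S⇒∈T s z∈A z≢x)

  same-token : Dominating G C → Independent G D → Swap A C x y → Swap A D x y′ →
               C ≡ D ⊎ Adjacent C D
  same-token {C = C} {D} {A} {x} {y} {y′} dom ind s t with y′ ≟ y
  ... | yes refl = inj₁ (trans (T≡ s) (sym (T≡ t)))
  ... | no y′≢y  = inj₂ (y , y′ , exchange⇒Swap D≡ dom ind (y∈T s) y′∉C)
    where
    open ≡-Reasoning
    D≡ : D ≡ C [ y ↦ y′ ]
    D≡ = begin
      D                      ≡⟨ T≡ t ⟩
      A [ x ↦ y′ ]           ≡⟨ ↦-∘ (y∉S s) ⟨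
      A [ x ↦ y ] [ y ↦ y′ ] ≡⟨ cong (_[ y ↦ y′ ]) (T≡ s) ⟨
      C [ y ↦ y′ ]           ∎
    y′∉C : y′ ∉ C
    y′∉C y′∈C with ∈T⁻ s y′∈C
    ... | inj₁ y′≡y        = y′≢y y′≡y
    ... | inj₂ (y′∈A , _) = y∉S t y′∈A

  same-added : Independent G A → Dominating G C → Independent G D →
               Swap A C x y → Swap A D x′ y → C ≡ D
  same-added {A = A} {C} {D} {x} {y} {x′} indA dom ind s t with x′ ≟ x
  ... | yes refl = trans (T≡ s) (sym (T≡ t))
  ... | no x′≢x  = contradiction (removed-adj-added dom ind x∈D (x∉T s) C⊆D)
                                 (independent⇒¬adj indA (x∈S t) (x∈S s))
    where
    x∈D : x ∈ D
    x∈D = ∈S⇒∈T t (x∈S s) (x′≢x ∘ sym)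
    C⊆D : ∀ {u} → u ∈ C → u ≢ x′ → u ∈ D
    C⊆D u∈C u≢x′ with ∈T⁻ s u∈C
    ... | inj₁ refl       = y∈T t
    ... | inj₂ (u∈A , _) = ∈S⇒∈T t u∈A u≢x′

  reverse-token : Swap S T x y → Swap T S u v → u ≡ y
  reverse-token s t with ∈T⁻ s (x∈S t)
  ... | inj₁ u≡y       = u≡y
  ... | inj₂ (u∈S , _) = contradiction u∈S (x∉T t)

  added-by-two-swaps : Swap A C x y → Swap C B x′ y′ → z ∈ B → z ∉ A → z ≡ y ⊎ z ≡ y′
  added-by-two-swaps s t z∈B z∉A with ∈T⁻ t z∈B
  ... | inj₁ z≡y′ = inj₂ z≡y′
  ... | inj₂ (z∈C , _) with ∈T⁻ s z∈C
  ...   | inj₁ z≡y       = inj₁ z≡y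
  ...   | inj₂ (z∈A , _) = contradiction z∈A z∉A

  adj-to-source⇒added : Independent G S → Swap S T x y → u ∈ S → adj G u v ≡ true →
                        v ∈ T → v ≡ y
  adj-to-source⇒added ind s u∈S u~v v∈T with ∈T⁻ s v∈T
  ... | inj₁ v≡y       = v≡y
  ... | inj₂ (v∈S , _) = contradiction u~v (independent⇒¬adj ind u∈S v∈S)

κa κb κc κd κe κf : Fin 6
κa = zero
κb = suc zero
κc = suc (suc zero)
κd = suc (suc (suc zero))
κe = suc (suc (suc (suc zero)))
κf = suc (suc (suc (suc (suc zero))))

module Realisation (G : Graph) (φ : Fin 6 → Subset (n G)) (iso : IsIsoFromκ G φ) where

  private
    variable
      j k l : Fin 6
      x y x′ y′ : Fin (n G)

    isISet : ∀ k → IsISet G (φ k)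
    isISet = proj₁ iso

  dom : ∀ k → Dominating G (φ k)
  dom k = proj₂ (proj₁ (isISet k))

  ind : ∀ k → Independent G (φ k)
  ind k = proj₁ (proj₁ (isISet k))

  swap : ∀ k l → κ-adj k l ≡ true → Adjacent G (φ k) (φ l)
  swap k l = ISetAdj⇒Adjacent G ∘ proj₁ (proj₂ (proj₂ (proj₂ iso)) k l)

  φ-injective : φ k ≡ φ l → k ≡ l
  φ-injective = proj₁ (proj₂ iso) _ _

  non-edge : κ-adj k l ≡ false → ¬ Adjacent G (φ k) (φ l)
  non-edge {k} {l} k≁l φk~φl with trans (sym k~l) k≁l
    where k~l = proj₂ (proj₂ (proj₂ (proj₂ iso)) k l) (Adjacent⇒ISetAdj G φk~φl)
  ... | ()

  apart : k ≢ l → κ-adj k l ≡ false → ¬ (φ k ≡ φ l ⊎ Adjacent G (φ k) (φ l))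
  apart k≢l k≁l = [ k≢l ∘ φ-injective , non-edge k≁l ]

  distinct-tokens : k ≢ l → κ-adj k l ≡ false →
                    Swap G (φ j) (φ k) x y → Swap G (φ j) (φ l) x′ y′ → x ≢ x′
  distinct-tokens {k = k} {l} k≢l k≁l s t refl = apart k≢l k≁l (same-token G (dom k) (ind l) s t)

  distinct-added : k ≢ l → Swap G (φ j) (φ k) x y → Swap G (φ j) (φ l) x′ y′ → y′ ≢ y
  distinct-added {k = k} {l} {j} k≢l s t refl =
    k≢l (φ-injective (same-added G (ind j) (dom k) (ind l) s t))

  first-added-survives : j ≢ l → κ-adj j l ≡ false →
                         Swap G (φ j) (φ k) x y → Swap G (φ k) (φ l) x′ y′ → y ∈ φ l
  first-added-survives {j = j} {l} {y = y} {x′} j≢l j≁l s t with x′ ≟ y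
  ... | yes refl = contradiction (backtrack G (dom j) (ind l) s t) (apart j≢l j≁l)
  ... | no x′≢y  = Swap.∈S⇒∈T t (Swap.y∈T s) (x′≢y ∘ sym)

proposition3p3 : ¬ (Σ Graph IGraphIsoκ)
proposition3p3 (G , φ , iso) =
  -- `pq` is the swap from φ κp to φ κq, and B, E, F in names stand for φ κb, φ κe, φ κf.
  let open Realisation G φ iso
      open Swap
      (x₁ , y₁ , ac) = swap κa κc refl
      (_  , y₂ , cb) = swap κc κb refl
      (x₃ , y₃ , ad) = swap κa κd refl
      (_  , y₄ , db) = swap κd κb refl
      (x₅ , _  , ae) = swap κa κe refl
      (_  , y₆ , ef) = swap κe κf refl
      (x₇ , _  , bf) = swap κb κf refl
      (_  , _  , bc) = swap κb κc refl
      (_  , _  , bd) = swap κb κd refl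
      y₃≢y₁ = distinct-added (λ ()) ac ad
      y₁∈B  = first-added-survives (λ ()) refl ac cb
      y₃∈B  = first-added-survives (λ ()) refl ad db
      y₃≡y₂ = fromInj₂ (⊥-elim ∘ y₃≢y₁) (added-by-two-swaps G ac cb y₃∈B (y∉S ad))
      y₁≡y₄ = fromInj₂ (⊥-elim ∘ y₃≢y₁ ∘ sym) (added-by-two-swaps G ad db y₁∈B (y∉S ac))
      y₂∈F  = ∈S⇒∈T bf (y∈T cb)
                (subst (_≢ x₇) (reverse-token G cb bc) (distinct-tokens (λ ()) refl bc bf))
      y₄∈F  = ∈S⇒∈T bf (y∈T db)
                (subst (_≢ x₇) (reverse-token G db bd) (distinct-tokens (λ ()) refl bd bf))
      x₁∈E  = ∈S⇒∈T ae (x∈S ac) (distinct-tokens (λ ()) refl ac ae)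
      x₃∈E  = ∈S⇒∈T ae (x∈S ad) (distinct-tokens (λ ()) refl ad ae)
      y₁≡y₆ = adj-to-source⇒added G (ind κe) ef x₁∈E (edge ac)
                (subst (_∈ φ κf) (sym y₁≡y₄) y₄∈F)
      y₃≡y₆ = adj-to-source⇒added G (ind κe) ef x₃∈E (edge ad)
                (subst (_∈ φ κf) (sym y₃≡y₂) y₂∈F)
  in y₃≢y₁ (trans y₃≡y₆ (sym y₁≡y₆))
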